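{- Every $*$-locally o-minimal structure $\mathcal M=(M,<,\ldots)$ is definably complete, i.e. every definable subset of $M$ has a supremum and an infimum in $M\cup\{\pm\infty\}$.
   Context: $\mathcal M$ is an expansion of a dense linear order without endpoints; "definable" means definable with parameters. A definable gap is a pair $(A,B)$ of nonempty definable subsets of $M$ with $M=A\cup B$, $a<b$ for all $a\in A,b\in B$, $A$ without largest element and $B$ without smallest element. The definable Dedekind completion is $\overline M=M\cup\{\text{definable gaps}\}$, linearly ordered in the natural way ($a<(A,B)$ iff $a\in A$ for $a\in M$; $(A_1,B_1)\le(A_2,B_2)$ iff $A_1\subseteq A_2$). For an open interval $I=(b_1,b_2)$ of $M$ ($b_i\in M\cup\{\pm\infty\}$), $\overline I=\{x\in\overline M: b_1<x<b_2\}$. $\mathcal M$ is $*$-locally o-minimal if for every definable $X\subseteq M$ and every $\bar a\in\overline M$ there exists an open interval $I$ of $M$ with $\bar a\in\overline I$ such that $X\cap I$ is a union of a finite set and finitely many open intervals. -}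

module Defs where

open import Level using (0ℓ)
open import Data.Nat using (ℕ; suc)
open import Data.Fin using (Fin; zero; suc)
open import Data.Vec.Functional using (_∷_)
open import Data.Product using (Σ; ∃; _×_; _,_)
open import Data.Sum using (_⊎_)
open import Data.Unit using (⊤)
import Data.Empty
open import Data.List using (List)
open import Data.List.Relation.Unary.Any using (Any)
open import Data.List.Membership.Propositional using (_∈_)
open import Relation.Binary.Core using (Rel)
open import Relation.Binary.Structures using (IsStrictTotalOrder)
open import Relation.Binary.PropositionalEquality using (_≡_)
open import Relation.Unary using (Pred; _⊆_)

-- An expansion M of a dense linear order without endpoints, presented by its
-- collection of definable (with parameters) sets: Def n X says that
-- X ⊆ M^n (tuples as functions Fin n → M) is definable.  The closure
-- conditions are exactly those satisfied by the definable sets of a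
-- first-order expansion of (M,<); conversely every such family is the family
-- of definable sets of the expansion by one relation symbol per member.
record Structure : Set₁ where
  field
    M    : Set
    _<_  : Rel M 0ℓ
    isStrictTotalOrder : IsStrictTotalOrder _≡_ _<_
    dense  : ∀ x y → x < y → ∃ λ z → (x < z) × (z < y)
    noMin  : ∀ x → ∃ λ y → y < x
    noMax  : ∀ x → ∃ λ y → x < y
    Def    : (n : ℕ) → Pred (Fin n → M) 0ℓ → Set
    def-ext   : ∀ {n} {X Y : Pred (Fin n → M) 0ℓ} →
                X ⊆ Y → Y ⊆ X → Def n X → Def n Y
    def-compl : ∀ {n} {X : Pred (Fin n → M) 0ℓ} →
                Def n X → Def n (λ v → X v → Data.Empty.⊥)
    def-inter : ∀ {n} {X Y : Pred (Fin n → M) 0ℓ} →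
                Def n X → Def n Y → Def n (λ v → X v × Y v)
    def-union : ∀ {n} {X Y : Pred (Fin n → M) 0ℓ} →
                Def n X → Def n Y → Def n (λ v → X v ⊎ Y v)
    -- substitution of variables (cylindrification, permutation, diagonal)
    def-subst : ∀ {m n} {X : Pred (Fin m → M) 0ℓ} (f : Fin m → Fin n) →
                Def m X → Def n (λ v → X (λ i → v (f i)))
    def-proj  : ∀ {n} {X : Pred (Fin (suc n) → M) 0ℓ} →
                Def (suc n) X → Def n (λ v → ∃ λ x → X (x ∷ v))
    def-eq    : Def 2 (λ v → v zero ≡ v (suc zero))
    def-lt    : Def 2 (λ v → v zero < v (suc zero))
    def-point : ∀ (a : M) → Def 1 (λ v → v zero ≡ a)

  open import Data.Empty public using (⊥)

  DefSet : Pred M 0ℓ → Set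
  DefSet X = Def 1 (λ v → X (v zero))

  _≤_ : Rel M 0ℓ
  x ≤ y = (x < y) ⊎ (x ≡ y)

  record Gap : Set₁ where
    field
      A B    : Pred M 0ℓ
      defA   : DefSet A
      defB   : DefSet B
      cover  : ∀ x → A x ⊎ B x
      sep    : ∀ a b → A a → B b → a < b
      A-ne   : ∃ λ a → A a
      B-ne   : ∃ λ b → B b
      A-nomax : ∀ a → A a → ∃ λ a' → A a' × (a < a')
      B-nomin : ∀ b → B b → ∃ λ b' → B b' × (b' < b)

  data M̄ : Set₁ where
    pt  : M → M̄
    gap : Gap → M̄

  data Ext : Set where
    -∞ : Ext
    [_] : M → Ext
    +∞ : Ext

  _<̄_ : Ext → M̄ → Set
  -∞    <̄ _       = ⊤
  [ b ] <̄ pt a    = b < a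
  [ b ] <̄ gap g   = Gap.A g b
  +∞    <̄ _       = Data.Empty.⊥

  _>̄_ : Ext → M̄ → Set
  -∞    >̄ _       = Data.Empty.⊥
  [ b ] >̄ pt a    = a < b
  [ b ] >̄ gap g   = Gap.B g b
  +∞    >̄ _       = ⊤

  _∈̄_ : M̄ → Ext × Ext → Set
  x ∈̄ (b₁ , b₂) = (b₁ <̄ x) × (b₂ >̄ x)

  data _≤ᴱ_ : Ext → Ext → Set where
    -∞≤ : ∀ {e} → -∞ ≤ᴱ e
    ≤+∞ : ∀ {e} → e ≤ᴱ +∞
    [≤] : ∀ {x y} → x ≤ y → [ x ] ≤ᴱ [ y ]

  _∈I_ : M → Ext × Ext → Set
  x ∈I (b₁ , b₂) = (b₁ <̄ pt x) × (b₂ >̄ pt x)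

  FiniteUnion : Pred M 0ℓ → Set
  FiniteUnion Y = Σ (List M) λ F → Σ (List (Ext × Ext)) λ Is →
    ∀ x → (Y x → (x ∈ F) ⊎ Any (λ J → x ∈I J) Is)
        × ((x ∈ F) ⊎ Any (λ J → x ∈I J) Is → Y x)

  StarLocallyOMinimal : Set₁
  StarLocallyOMinimal = ∀ (X : Pred M 0ℓ) → DefSet X → ∀ (ā : M̄) →
    Σ (Ext × Ext) λ I → (ā ∈̄ I) × FiniteUnion (λ x → X x × (x ∈I I))

  IsSup : Pred M 0ℓ → Ext → Set
  IsSup X s = (∀ x → X x → [ x ] ≤ᴱ s) ×
              (∀ t → (∀ x → X x → [ x ] ≤ᴱ t) → s ≤ᴱ t)

  IsInf : Pred M 0ℓ → Ext → Set
  IsInf X s = (∀ x → X x → s ≤ᴱ [ x ]) ×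
              (∀ t → (∀ x → X x → t ≤ᴱ [ x ]) → t ≤ᴱ s)

  DefinablyComplete : Set₁
  DefinablyComplete = ∀ (X : Pred M 0ℓ) → DefSet X →
    (∃ λ s → IsSup X s) × (∃ λ i → IsInf X i)

-- Let A be the set of points below some element of a nonempty definable X;
-- its complement B is the set of upper bounds of X.  If B is empty or has a
-- least element, that is sup X.  Otherwise (A , B) is a definable gap in which
-- X ⊆ A is cofinal.  Near the gap, X is a finite union of points and open
-- intervals; an element of X above all the finitely many of these data lying
-- in A belongs to an interval whose right end lies in B, so that interval
-- contains points of B, which are not in X.  Infima are suprema for the
-- reversed order.

module Submission where

open import Defs
open import Level using (0ℓ)
open import Axiom.ExcludedMiddle using (ExcludedMiddle)
open import Data.Fin using (Fin; zero; suc)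
open import Data.Product using (∃; _×_; _,_; proj₁; proj₂)
open import Data.Sum using (_⊎_; inj₁; inj₂; swap; map₂)
open import Function using (flip; _∘_)
open import Data.Unit using (tt)
open import Data.Empty using (⊥-elim)
open import Data.List using (List; []; _∷_; map; _++_)
import Data.List.Relation.Unary.Any as Any
open import Data.List.Relation.Unary.Any using (Any; here; there)
open import Data.List.Relation.Unary.Any.Properties using (map⁺; map⁻)
open import Data.List.Membership.Propositional using (_∈_; find; lose)
open import Data.List.Membership.Propositional.Properties using (∈-++⁺ˡ; ∈-++⁺ʳ; ∈-map⁺)
open import Relation.Binary.PropositionalEquality using (_≡_; refl; sym; subst)
open import Relation.Binary.Structures using (IsStrictTotalOrder)
open import Relation.Binary.Definitions using (tri<; tri≈; tri>)
import Relation.Binary.Construct.Flip.EqAndOrd as Flip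
open import Relation.Nullary using (¬_; yes; no)
open import Relation.Nullary.Decidable using (toSum)
open import Relation.Unary using (Pred; _⊆_)

swap₂ : Fin 2 → Fin 2
swap₂ zero = suc zero
swap₂ (suc _) = zero

module Completeness (𝓜 : Structure) where
  open Structure 𝓜
  open IsStrictTotalOrder isStrictTotalOrder using (compare; irrefl; trans)

  <-irrefl : ∀ {x} → ¬ x < x
  <-irrefl = irrefl refl

  ≤-<-trans : ∀ {x y z} → x ≤ y → y < z → x < z
  ≤-<-trans (inj₁ x<y) y<z = trans x<y y<z
  ≤-<-trans (inj₂ refl) y<z = y<z

  <-≤-trans : ∀ {x y z} → x < y → y ≤ z → x < z
  <-≤-trans x<y (inj₁ y<z) = trans x<y y<z
  <-≤-trans x<y (inj₂ refl) = x<y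

  <⊎≥ : ∀ x y → x < y ⊎ y ≤ x
  <⊎≥ x y with compare x y
  ... | tri< x<y _ _ = inj₁ x<y
  ... | tri≈ _ x≡y _ = inj₂ (inj₂ (sym x≡y))
  ... | tri> _ _ y<x = inj₂ (inj₁ y<x)

  <̄-pt-trans : ∀ e {x y} → e <̄ pt x → x < y → e <̄ pt y
  <̄-pt-trans -∞ _ _ = tt
  <̄-pt-trans [ c ] c<x x<y = trans c<x x<y

  finitePoints : List Ext → List M
  finitePoints [] = []
  finitePoints (-∞ ∷ es) = finitePoints es
  finitePoints ([ c ] ∷ es) = c ∷ finitePoints es
  finitePoints (+∞ ∷ es) = finitePoints es

  ∈-finitePoints : ∀ {c es} → [ c ] ∈ es → c ∈ finitePoints es
  ∈-finitePoints (here refl) = here refl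
  ∈-finitePoints {es = -∞ ∷ _} (there m) = ∈-finitePoints m
  ∈-finitePoints {es = [ _ ] ∷ _} (there m) = there (∈-finitePoints m)
  ∈-finitePoints {es = +∞ ∷ _} (there m) = ∈-finitePoints m

  module GapProperties (g : Gap) where
    open Gap g

    A∩B-empty : ∀ {x} → A x → ¬ B x
    A∩B-empty Ax Bx = <-irrefl (sep _ _ Ax Bx)

    A-aboveBoth : ∀ {a y} → A a → A y → ∃ λ a' → A a' × a < a' × y < a'
    A-aboveBoth {a} {y} Aa Ay with <⊎≥ a y
    ... | inj₁ a<y = let a' , Aa' , y<a' = A-nomax y Ay in a' , Aa' , trans a<y y<a' , y<a'
    ... | inj₂ y≤a = let a' , Aa' , a<a' = A-nomax a Aa in a' , Aa' , a<a' , ≤-<-trans y≤a a<a'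

    A-aboveFinite : (L : List M) → ∃ λ a → A a × (∀ {y} → y ∈ L → A y → y < a)
    A-aboveFinite [] = let a , Aa = A-ne in a , Aa , λ ()
    A-aboveFinite (y ∷ L) with A-aboveFinite L | cover y
    ... | a , Aa , bound | inj₂ By = a , Aa , λ { (here refl) Ay → ⊥-elim (A∩B-empty Ay By)
                                              ; (there m) → bound m }
    ... | a , Aa , bound | inj₁ Ay =
      let a' , Aa' , a<a' , y<a' = A-aboveBoth Aa Ay
      in a' , Aa' , λ { (here refl) _ → y<a' ; (there m) Ay' → trans (bound m Ay') a<a' }

    above-gap⇒above-A : ∀ e → e >̄ gap g → ∀ {x} → A x → e >̄ pt x
    above-gap⇒above-A [ d ] Bd Ax = sep _ d Ax Bd
    above-gap⇒above-A +∞ _ _ = tt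

    B-below : ∀ e → e >̄ gap g → ∃ λ b → B b × e >̄ pt b
    B-below [ d ] Bd = let b , Bb , b<d = B-nomin d Bd in b , Bb , b<d
    B-below +∞ _ = let b , Bb = B-ne in b , Bb , tt

  module _ (slo : StarLocallyOMinimal) (g : Gap) where
    open Gap g
    open GapProperties g

    ¬definable-cofinal-below-gap : ∀ {X} → DefSet X → X ⊆ A →
                                   (∀ a → A a → ∃ λ x → X x × a < x) → ⊥
    ¬definable-cofinal-below-gap {X} defX X⊆A cofinal with slo X defX (gap g)
    ... | (e₁ , e₂) , (e₁<g , e₂>g) , F , Is , X∩I-finite
        with A-aboveFinite (finitePoints (e₁ ∷ map proj₂ Is) ++ F)
    ... | a , Aa , below-a with cofinal a Aa
    ... | x , Xx , a<x = x-covered (proj₁ (X∩I-finite x) (Xx , x∈I))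
      where
      ends : List Ext
      ends = e₁ ∷ map proj₂ Is

      Ax : A x
      Ax = X⊆A Xx

      end-below-x : ∀ e → e ∈ ends → e <̄ gap g → e <̄ pt x
      end-below-x -∞ _ _ = tt
      end-below-x [ c ] m Ac = trans (below-a (∈-++⁺ˡ (∈-finitePoints m)) Ac) a<x

      end-above-x⇒above-gap : ∀ e → e ∈ ends → e >̄ pt x → e >̄ gap g
      end-above-x⇒above-gap [ c ] m x<c with cover c
      ... | inj₂ Bc = Bc
      ... | inj₁ Ac =
        ⊥-elim (<-irrefl (trans (trans (below-a (∈-++⁺ˡ (∈-finitePoints m)) Ac) a<x) x<c))
      end-above-x⇒above-gap +∞ _ _ = tt

      x∈I : x ∈I (e₁ , e₂)
      x∈I = end-below-x e₁ (here refl) e₁<g , above-gap⇒above-A e₂ e₂>g Ax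

      x-covered : x ∈ F ⊎ Any (x ∈I_) Is → ⊥
      x-covered (inj₁ x∈F) = <-irrefl (trans (below-a (∈-++⁺ʳ _ x∈F) Ax) a<x)
      x-covered (inj₂ x∈⋃Is) with find x∈⋃Is
      ... | (c₁ , c₂) , J∈Is , (c₁<x , c₂>x) =
        let b , Bb , c₂>b = B-below c₂ (end-above-x⇒above-gap c₂ (there (∈-map⁺ proj₂ J∈Is)) c₂>x)
            b∈J = <̄-pt-trans c₁ c₁<x (sep x b Ax Bb) , c₂>b
            Xb = proj₁ (proj₂ (X∩I-finite b) (inj₂ (lose J∈Is b∈J)))
        in A∩B-empty (X⊆A Xb) Bb

  Below : Pred M 0ℓ → Pred M 0ℓ
  Below X a = ∃ λ x → X x × a < x

  Below-definable : ∀ {X} → DefSet X → DefSet (Below X)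
  Below-definable defX =
    def-proj (def-inter (def-subst {1} {2} (λ _ → zero) defX) (def-subst {2} {2} swap₂ def-lt))

  ¬Below⇒upper : ∀ {X b} → ¬ Below X b → ∀ x → X x → x ≤ b
  ¬Below⇒upper {b = b} b∉ x Xx with <⊎≥ b x
  ... | inj₁ b<x = ⊥-elim (b∉ (x , Xx , b<x))
  ... | inj₂ x≤b = x≤b

  upper⇒¬Below : ∀ {X t} → (∀ x → X x → [ x ] ≤ᴱ [ t ]) → ¬ Below X t
  upper⇒¬Below upper (x , Xx , t<x) with upper x Xx
  ... | [≤] x≤t = <-irrefl (≤-<-trans x≤t t<x)

  ¬upper-∞ : ∀ {X : Pred M 0ℓ} {x} → X x → ¬ (∀ y → X y → [ y ] ≤ᴱ -∞)
  ¬upper-∞ Xx upper with upper _ Xx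
  ... | ()

  Least : Pred M 0ℓ → Pred M 0ℓ
  Least P b = P b × (∀ c → P c → b ≤ c)

  module _ (lem : ExcludedMiddle 0ℓ) {X : Pred M 0ℓ}
           (no-least : ¬ ∃ (Least (λ b → ¬ Below X b))) where

    X⊆Below : X ⊆ Below X
    X⊆Below {x} Xx with lem {Below X x}
    ... | yes x∈ = x∈
    ... | no x∉ = ⊥-elim (no-least (x , x∉ , λ c c∉ → ¬Below⇒upper c∉ x Xx))

    upper-bounds-nomin : ∀ b → ¬ Below X b → ∃ λ b' → ¬ Below X b' × b' < b
    upper-bounds-nomin b b∉ with lem {∃ λ b' → ¬ Below X b' × b' < b}
    ... | yes smaller = smaller
    ... | no ¬smaller = ⊥-elim (no-least (b , b∉ , b-least))
      where
      b-least : ∀ c → ¬ Below X c → b ≤ c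
      b-least c c∉ with <⊎≥ c b
      ... | inj₁ c<b = ⊥-elim (¬smaller (c , c∉ , c<b))
      ... | inj₂ b≤c = b≤c

    supGap : DefSet X → ∃ X → ∃ (λ b → ¬ Below X b) → Gap
    supGap defX (x₀ , Xx₀) B-ne = record
      { A = Below X ; B = λ b → ¬ Below X b
      ; defA = Below-definable defX ; defB = def-compl (Below-definable defX)
      ; cover = λ x → toSum (lem {Below X x})
      ; sep = below<upper
      ; A-ne = let a , a<x₀ = noMin x₀ in a , x₀ , Xx₀ , a<x₀
      ; B-ne = B-ne
      ; A-nomax = λ { a (x , Xx , a<x) → let z , a<z , z<x = dense a x a<x in z , (x , Xx , z<x) , a<z }
      ; B-nomin = upper-bounds-nomin }
      where
      below<upper : ∀ a b → Below X a → ¬ Below X b → a < b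
      below<upper a b (x , Xx , a<x) b∉ = <-≤-trans a<x (¬Below⇒upper b∉ x Xx)

  sup-exists : ExcludedMiddle 0ℓ → StarLocallyOMinimal → ∀ X → DefSet X → ∃ (IsSup X)
  sup-exists lem slo X defX with lem {∃ X}
  ... | no X-empty = -∞ , (λ x Xx → ⊥-elim (X-empty (x , Xx))) , (λ _ _ → -∞≤)
  ... | yes (x₀ , Xx₀) with lem {∃ λ b → ¬ Below X b}
  ... | no unbounded = +∞ , (λ _ _ → ≤+∞) , +∞-least
    where
    +∞-least : ∀ t → (∀ x → X x → [ x ] ≤ᴱ t) → +∞ ≤ᴱ t
    +∞-least -∞ upper = ⊥-elim (¬upper-∞ Xx₀ upper)
    +∞-least [ t ] upper = ⊥-elim (unbounded (t , upper⇒¬Below upper))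
    +∞-least +∞ _ = ≤+∞
  ... | yes (b₀ , b₀∉) with lem {∃ (Least (λ b → ¬ Below X b))}
  ... | yes (b , b∉ , b≤) = [ b ] , (λ x Xx → [≤] (¬Below⇒upper b∉ x Xx)) , b-least
    where
    b-least : ∀ t → (∀ x → X x → [ x ] ≤ᴱ t) → [ b ] ≤ᴱ t
    b-least -∞ upper = ⊥-elim (¬upper-∞ Xx₀ upper)
    b-least [ t ] upper = [≤] (b≤ t (upper⇒¬Below upper))
    b-least +∞ _ = ≤+∞
  ... | no no-least =
    ⊥-elim (¬definable-cofinal-below-gap slo (supGap lem no-least defX (x₀ , Xx₀) (b₀ , b₀∉))
              defX (X⊆Below lem no-least) (λ _ below → below))

dual : Structure → Structure
dual 𝓜 = record
  { M = M ; _<_ = flip _<_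
  ; isStrictTotalOrder = Flip.isStrictTotalOrder isStrictTotalOrder
  ; dense = λ x y y<x → let z , y<z , z<x = dense y x y<x in z , z<x , y<z
  ; noMin = noMax ; noMax = noMin
  ; Def = Def ; def-ext = def-ext ; def-compl = def-compl ; def-inter = def-inter
  ; def-union = def-union ; def-subst = def-subst ; def-proj = def-proj
  ; def-eq = def-eq ; def-lt = def-subst swap₂ def-lt ; def-point = def-point }
  where open Structure 𝓜

module Duality (𝓜 : Structure) where
  module 𝓜 = Structure 𝓜
  module 𝓜ᵒᵖ = Structure (dual 𝓜)

  reverse : 𝓜.Ext → 𝓜ᵒᵖ.Ext
  reverse 𝓜.-∞ = 𝓜ᵒᵖ.+∞
  reverse 𝓜.[ x ] = 𝓜ᵒᵖ.[ x ]
  reverse 𝓜.+∞ = 𝓜ᵒᵖ.-∞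

  unreverse : 𝓜ᵒᵖ.Ext → 𝓜.Ext
  unreverse 𝓜ᵒᵖ.-∞ = 𝓜.+∞
  unreverse 𝓜ᵒᵖ.[ x ] = 𝓜.[ x ]
  unreverse 𝓜ᵒᵖ.+∞ = 𝓜.-∞

  reverseInterval : 𝓜.Ext × 𝓜.Ext → 𝓜ᵒᵖ.Ext × 𝓜ᵒᵖ.Ext
  reverseInterval (e₁ , e₂) = reverse e₂ , reverse e₁

  unopGap : 𝓜ᵒᵖ.Gap → 𝓜.Gap
  unopGap g = record
    { A = B ; B = A ; defA = defB ; defB = defA
    ; cover = λ x → swap (cover x) ; sep = λ a b Ba Ab → sep b a Ab Ba
    ; A-ne = B-ne ; B-ne = A-ne ; A-nomax = B-nomin ; B-nomin = A-nomax }
    where open 𝓜ᵒᵖ.Gap g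

  unop : 𝓜ᵒᵖ.M̄ → 𝓜.M̄
  unop (𝓜ᵒᵖ.pt a) = 𝓜.pt a
  unop (𝓜ᵒᵖ.gap g) = 𝓜.gap (unopGap g)

  reverse-< : ∀ e ā → e 𝓜.<̄ unop ā → reverse e 𝓜ᵒᵖ.>̄ ā
  reverse-< 𝓜.-∞ _ _ = tt
  reverse-< 𝓜.[ _ ] (𝓜ᵒᵖ.pt _) c<a = c<a
  reverse-< 𝓜.[ _ ] (𝓜ᵒᵖ.gap _) Bc = Bc

  reverse-> : ∀ e ā → e 𝓜.>̄ unop ā → reverse e 𝓜ᵒᵖ.<̄ ā
  reverse-> 𝓜.[ _ ] (𝓜ᵒᵖ.pt _) a<c = a<c
  reverse-> 𝓜.[ _ ] (𝓜ᵒᵖ.gap _) Ac = Ac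
  reverse-> 𝓜.+∞ _ _ = tt

  unreverse-< : ∀ e {a} → reverse e 𝓜ᵒᵖ.>̄ 𝓜ᵒᵖ.pt a → e 𝓜.<̄ 𝓜.pt a
  unreverse-< 𝓜.-∞ _ = tt
  unreverse-< 𝓜.[ _ ] c<a = c<a

  unreverse-> : ∀ e {a} → reverse e 𝓜ᵒᵖ.<̄ 𝓜ᵒᵖ.pt a → e 𝓜.>̄ 𝓜.pt a
  unreverse-> 𝓜.[ _ ] a<c = a<c
  unreverse-> 𝓜.+∞ _ = tt

  ∈I-reverse : ∀ {x} J → x 𝓜.∈I J → x 𝓜ᵒᵖ.∈I reverseInterval J
  ∈I-reverse (e₁ , e₂) (e₁<x , e₂>x) = reverse-> e₂ (𝓜ᵒᵖ.pt _) e₂>x , reverse-< e₁ (𝓜ᵒᵖ.pt _) e₁<x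

  ∈I-unreverse : ∀ {x} J → x 𝓜ᵒᵖ.∈I reverseInterval J → x 𝓜.∈I J
  ∈I-unreverse (e₁ , e₂) (e₂>x , e₁<x) = unreverse-< e₁ e₁<x , unreverse-> e₂ e₂>x

  StarLocallyOMinimal-dual : 𝓜.StarLocallyOMinimal → 𝓜ᵒᵖ.StarLocallyOMinimal
  StarLocallyOMinimal-dual slo X defX ā with slo X defX (unop ā)
  ... | I@(e₁ , e₂) , (e₁<ā , e₂>ā) , F , Is , X∩I-finite =
    reverseInterval I , (reverse-> e₂ ā e₂>ā , reverse-< e₁ ā e₁<ā) , F , map reverseInterval Is ,
    λ x → (λ (Xx , x∈I) → map₂ reverse-any (proj₁ (X∩I-finite x) (Xx , ∈I-unreverse I x∈I))) ,
          (λ covered → let Xx , x∈I = proj₂ (X∩I-finite x) (map₂ unreverse-any covered)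
                       in Xx , ∈I-reverse I x∈I)
    where
    reverse-any : ∀ {x} → Any (x 𝓜.∈I_) Is → Any (x 𝓜ᵒᵖ.∈I_) (map reverseInterval Is)
    reverse-any = map⁺ ∘ Any.map (λ {J} → ∈I-reverse J)
    unreverse-any : ∀ {x} → Any (x 𝓜ᵒᵖ.∈I_) (map reverseInterval Is) → Any (x 𝓜.∈I_) Is
    unreverse-any = Any.map (λ {J} → ∈I-unreverse J) ∘ map⁻

  unreverse-reverse : ∀ e → unreverse (reverse e) ≡ e
  unreverse-reverse 𝓜.-∞ = refl
  unreverse-reverse 𝓜.[ _ ] = refl
  unreverse-reverse 𝓜.+∞ = refl

  reverse-≤ᴱ : ∀ {s t} → s 𝓜.≤ᴱ t → reverse t 𝓜ᵒᵖ.≤ᴱ reverse s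
  reverse-≤ᴱ 𝓜.-∞≤ = 𝓜ᵒᵖ.≤+∞
  reverse-≤ᴱ 𝓜.≤+∞ = 𝓜ᵒᵖ.-∞≤
  reverse-≤ᴱ (𝓜.[≤] (inj₁ s<t)) = 𝓜ᵒᵖ.[≤] (inj₁ s<t)
  reverse-≤ᴱ (𝓜.[≤] (inj₂ refl)) = 𝓜ᵒᵖ.[≤] (inj₂ refl)

  unreverse-≤ᴱ : ∀ {s t} → s 𝓜ᵒᵖ.≤ᴱ t → unreverse t 𝓜.≤ᴱ unreverse s
  unreverse-≤ᴱ 𝓜ᵒᵖ.-∞≤ = 𝓜.≤+∞
  unreverse-≤ᴱ 𝓜ᵒᵖ.≤+∞ = 𝓜.-∞≤
  unreverse-≤ᴱ (𝓜ᵒᵖ.[≤] (inj₁ t<s)) = 𝓜.[≤] (inj₁ t<s)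
  unreverse-≤ᴱ (𝓜ᵒᵖ.[≤] (inj₂ refl)) = 𝓜.[≤] (inj₂ refl)

  IsSup-dual⇒IsInf : ∀ {X s} → 𝓜ᵒᵖ.IsSup X s → 𝓜.IsInf X (unreverse s)
  IsSup-dual⇒IsInf {s = s} (upper , least) =
    (λ x Xx → unreverse-≤ᴱ (upper x Xx)) ,
    (λ t lower → subst (𝓜._≤ᴱ unreverse s) (unreverse-reverse t)
                   (unreverse-≤ᴱ (least (reverse t) (λ x Xx → reverse-≤ᴱ (lower x Xx)))))

proposition2p13 : ExcludedMiddle 0ℓ → (𝓜 : Structure) →
    Structure.StarLocallyOMinimal 𝓜 → Structure.DefinablyComplete 𝓜
proposition2p13 lem 𝓜 slo X defX =
  Completeness.sup-exists 𝓜 lem slo X defX ,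
  (let s , s-sup = Completeness.sup-exists (dual 𝓜) lem (StarLocallyOMinimal-dual slo) X defX
   in unreverse s , IsSup-dual⇒IsInf s-sup)
  where open Duality 𝓜
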